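{- Let $(a_n)_{n\ge1}$ be defined by \[ a_1 = -1, \qquad a_n = -\sum_{r=\lceil n/2\rceil}^{n-1} \binom{r}{n-r} a_r \quad (n \ge 2). \] Then $a_n = (-1)^n C_n$ for all $n\ge 1$, where $C_n$ denotes the $n$-th Catalan number in the indexing $C_{n+1} = \frac{1}{n+1}\binom{2n}{n}$ (so $C_1=1, C_2=1, C_3=2, C_4=5, \dots$). In particular $(a_n)$ grows exponentially. -}

module Defs where

open import Data.Nat using (ℕ; zero; suc; _∸_; _≤?_; _/_) renaming (_+_ to _+ℕ_; _*_ to _*ℕ_)
open import Data.Nat.Combinatorics using (_C_)
open import Data.Integer using (ℤ; +_; -_; _*_; _+_)
open import Data.List using (List; []; _∷_; upTo; map; foldr)
open import Relation.Nullary using (yes; no)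

⌈_/2⌉ : ℕ → ℕ
⌈ n /2⌉ = (n +ℕ 1) / 2

range : ℕ → ℕ → List ℕ
range lo hi = map (lo +ℕ_) (upTo (suc hi ∸ lo))

sumℤ : List ℤ → ℤ
sumℤ = foldr _+_ (+ 0)

-- One step of the recursion: given the values a_r (as a function of r),
-- compute a_n = - Σ_{r = ⌈n/2⌉}^{n-1} C(r, n-r) a_r   (for n ≥ 2),
-- with a_1 = -1.  (a_0 is not part of the sequence; set to 0.)
step : (ℕ → ℤ) → ℕ → ℤ
step prev zero = + 0
step prev (suc zero) = - (+ 1)
step prev n@(suc (suc _)) =
  - sumℤ (map (λ r → (+ (r C (n ∸ r))) * prev r) (range ⌈ n /2⌉ (n ∸ 1)))

-- tbl k r : the value a_r, correct for all r ≤ k (built by structural recursion on k;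
-- step only consults indices r < n).
tbl : ℕ → ℕ → ℤ
tbl zero r = step (λ _ → + 0) r
tbl (suc k) r with r ≤? k
... | yes _ = tbl k r
... | no  _ = step (tbl k) r

a : ℕ → ℤ
a n = tbl n n

Cat : ℕ → ℕ
Cat zero = 0
Cat (suc m) = ((2 *ℕ m) C m) / (suc m)

-- Let C(y) = ∑ᵣ (−1)ʳ Cat r yʳ = (1 − √(1 + 4y)) / 2. Since 1 + 4(x + x²) = (1 + 2x)², the
-- substitution y = x + x² gives C(x + x²) = −x. As [xⁿ] (x + x²)ʳ = r C (n − r), the vanishing
-- of the coefficient of xⁿ for n ≥ 2 says  ∑_{⌈n/2⌉ ≤ r ≤ n} r C (n − r) (−1)ʳ Cat r = 0,  which
-- is the recursion defining a. Square roots are avoided by working with differential equations: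
-- the Catalan recurrence says (1 + 4y) C′ = 2C − 1, hence H(x) = C(x + x²) satisfies
-- (1 + 2x) H′ = 2H − 1, and this recursion for the coefficients of H, started from H = −x + O(x³),
-- keeps all further coefficients zero.

module Submission where

module Binomial where
  open import Data.Nat
  open import Data.Nat.Properties
  open import Data.Nat.Combinatorics
  open import Data.Nat.Tactic.RingSolver using (solve-∀)
  open import Relation.Binary.PropositionalEquality
  open ≡-Reasoning

  [1+k]*[1+n]C[1+k]≡[1+n]*nCk : ∀ n k → suc k * (suc n C suc k) ≡ suc n * (n C k)
  [1+k]*[1+n]C[1+k]≡[1+n]*nCk zero    zero    = refl
  [1+k]*[1+n]C[1+k]≡[1+n]*nCk zero    (suc k) = *-zeroʳ (suc (suc k))
  [1+k]*[1+n]C[1+k]≡[1+n]*nCk (suc n) zero    = begin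
    1 * (suc (suc n) C 1) ≡⟨ *-identityˡ _ ⟩
    suc (suc n) C 1       ≡⟨ nC1≡n (suc (suc n)) ⟩
    suc (suc n)           ≡⟨ *-identityʳ _ ⟨
    suc (suc n) * 1       ∎
  [1+k]*[1+n]C[1+k]≡[1+n]*nCk (suc n) (suc k) = begin
    suc (suc k) * (suc (suc n) C suc (suc k))
      ≡⟨ cong (suc (suc k) *_) (nCk+nC[k+1]≡[n+1]C[k+1] (suc n) (suc k)) ⟨
    suc (suc k) * (suc n C suc k + suc n C suc (suc k))
      ≡⟨ distribute (suc k) (suc n C suc k) (suc n C suc (suc k)) ⟩
    suc k * (suc n C suc k) + suc (suc k) * (suc n C suc (suc k)) + suc n C suc k
      ≡⟨ cong₂ (λ x y → x + y + suc n C suc k)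
           ([1+k]*[1+n]C[1+k]≡[1+n]*nCk n k) ([1+k]*[1+n]C[1+k]≡[1+n]*nCk n (suc k)) ⟩
    suc n * (n C k) + suc n * (n C suc k) + suc n C suc k
      ≡⟨ cong (_+ suc n C suc k) (*-distribˡ-+ (suc n) (n C k) (n C suc k)) ⟨
    suc n * (n C k + n C suc k) + suc n C suc k
      ≡⟨ cong (λ x → suc n * x + suc n C suc k) (nCk+nC[k+1]≡[n+1]C[k+1] n k) ⟩
    suc n * (suc n C suc k) + suc n C suc k
      ≡⟨ +-comm (suc n * (suc n C suc k)) _ ⟩
    suc (suc n) * (suc n C suc k) ∎
    where
    distribute : ∀ a x y → suc a * (x + y) ≡ a * x + suc a * y + x
    distribute = solve-∀

  [k+a]Ck≡[k+a]Ca : ∀ k a → (k + a) C k ≡ (k + a) C a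
  [k+a]Ck≡[k+a]Ca k a = trans (nCk≡nC[n∸k] (m≤m+n k a)) (cong ((k + a) C_) (m+n∸m≡n k a))

  [1+k]*[k+1+a]C[1+k]≡[1+a]*[k+1+a]Ck : ∀ k a → suc k * ((k + suc a) C suc k) ≡ suc a * ((k + suc a) C k)
  [1+k]*[k+1+a]C[1+k]≡[1+a]*[k+1+a]Ck k a rewrite +-suc k a = begin
    suc k * (suc (k + a) C suc k) ≡⟨ [1+k]*[1+n]C[1+k]≡[1+n]*nCk (k + a) k ⟩
    suc (k + a) * ((k + a) C k)   ≡⟨ cong (suc (k + a) *_) ([k+a]Ck≡[k+a]Ca k a) ⟩
    suc (k + a) * ((k + a) C a)   ≡⟨ [1+k]*[1+n]C[1+k]≡[1+n]*nCk (k + a) a ⟨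
    suc a * (suc (k + a) C suc a) ≡⟨ cong (suc a *_) (subst (λ n → n C k ≡ n C suc a) (+-suc k a) ([k+a]Ck≡[k+a]Ca k (suc a))) ⟨
    suc a * (suc (k + a) C k)     ∎

  m*[2m]Cm≡[1+m]*[2m]C[1+m] : ∀ m → m * ((2 * m) C m) ≡ suc m * ((2 * m) C suc m)
  m*[2m]Cm≡[1+m]*[2m]C[1+m] zero    = refl
  m*[2m]Cm≡[1+m]*[2m]C[1+m] (suc i) = begin
    suc i * ((2 * suc i) C suc i)                 ≡⟨ cong (λ n → suc i * (n C suc i)) (double i) ⟩
    suc i * ((suc i + suc i) C suc i)             ≡⟨ [1+k]*[k+1+a]C[1+k]≡[1+a]*[k+1+a]Ck (suc i) i ⟨
    suc (suc i) * ((suc i + suc i) C suc (suc i)) ≡⟨ cong (λ n → suc (suc i) * (n C suc (suc i))) (double i) ⟨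
    suc (suc i) * ((2 * suc i) C suc (suc i))     ∎
    where
    double : ∀ i → 2 * suc i ≡ suc i + suc i
    double = solve-∀

  [1+m]*[2+2m]C[1+m]≡2*[1+2m]*[2m]Cm : ∀ m → suc m * ((2 * suc m) C suc m) ≡ 2 * suc (2 * m) * ((2 * m) C m)
  [1+m]*[2+2m]C[1+m]≡2*[1+2m]*[2m]Cm m = begin
    suc m * ((2 * suc m) C suc m)   ≡⟨ cong (λ k → suc m * (k C suc m)) (2*[1+m]≡2+2m m) ⟩
    suc m * (suc (suc n) C suc m)   ≡⟨ [1+k]*[1+n]C[1+k]≡[1+n]*nCk (suc n) m ⟩
    suc (suc n) * (suc n C m)
      ≡⟨ cong (suc (suc n) *_) (subst (λ k → k C m ≡ k C suc m) (m+[1+m]≡1+2m m) ([k+a]Ck≡[k+a]Ca m (suc m))) ⟩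
    suc (suc n) * (suc n C suc m)   ≡⟨ [2+2m]*x≡2*[[1+m]*x] m (suc n C suc m) ⟩
    2 * (suc m * (suc n C suc m))   ≡⟨ cong (2 *_) ([1+k]*[1+n]C[1+k]≡[1+n]*nCk n m) ⟩
    2 * (suc n * (n C m))           ≡⟨ *-assoc 2 (suc n) (n C m) ⟨
    2 * suc n * (n C m)             ∎
    where
    n = 2 * m
    2*[1+m]≡2+2m : ∀ m → 2 * suc m ≡ suc (suc (2 * m))
    2*[1+m]≡2+2m = solve-∀
    m+[1+m]≡1+2m : ∀ m → m + suc m ≡ suc (2 * m)
    m+[1+m]≡1+2m = solve-∀
    [2+2m]*x≡2*[[1+m]*x] : ∀ m x → suc (suc (2 * m)) * x ≡ 2 * (suc m * x)
    [2+2m]*x≡2*[[1+m]*x] = solve-∀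

  [2+r+j]*[1+r]C[1+j]≡[1+r]*[rC[1+j]+2*rCj] : ∀ r j → suc (r + suc j) * (suc r C suc j) ≡ suc r * (r C suc j + 2 * (r C j))
  [2+r+j]*[1+r]C[1+j]≡[1+r]*[rC[1+j]+2*rCj] r j = begin
    suc (r + suc j) * X                                ≡⟨ split-factor r j X ⟩
    suc r * X + suc j * X
      ≡⟨ cong₂ _+_ (cong (suc r *_) (sym (nCk+nC[k+1]≡[n+1]C[k+1] r j))) ([1+k]*[1+n]C[1+k]≡[1+n]*nCk r j) ⟩
    suc r * (r C j + r C suc j) + suc r * (r C j)      ≡⟨ collect r (r C j) (r C suc j) ⟩
    suc r * (r C suc j + 2 * (r C j))                  ∎
    where
    X = suc r C suc j
    split-factor : ∀ r j x → suc (r + suc j) * x ≡ suc r * x + suc j * x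
    split-factor = solve-∀
    collect : ∀ r a b → suc r * (a + b) + suc r * a ≡ suc r * (b + 2 * a)
    collect = solve-∀

module Catalan where
  open import Data.Nat
  open import Data.Nat.Properties
  open import Data.Nat.Combinatorics using (_C_)
  open import Data.Nat.Divisibility using (divides)
  open import Data.Nat.DivMod using (m*[n/m]≡n)
  open import Data.Nat.Tactic.RingSolver using (solve-∀)
  open import Relation.Binary.PropositionalEquality
  open ≡-Reasoning
  open import Defs using (Cat)
  open Binomial

  [1+m]*Cat[1+m]≡[2m]Cm : ∀ m → suc m * Cat (suc m) ≡ (2 * m) C m
  [1+m]*Cat[1+m]≡[2m]Cm m = m*[n/m]≡n (divides (X ∸ Y) (trans X≡[1+m]*[X∸Y] (*-comm (suc m) (X ∸ Y))))
    where
    X = (2 * m) C m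
    Y = (2 * m) C suc m
    X≡[1+m]*[X∸Y] : X ≡ suc m * (X ∸ Y)
    X≡[1+m]*[X∸Y] = begin
      X                     ≡⟨ m+n∸n≡m X (m * X) ⟨
      X + m * X ∸ m * X     ≡⟨ cong (X + m * X ∸_) (m*[2m]Cm≡[1+m]*[2m]C[1+m] m) ⟩
      suc m * X ∸ suc m * Y ≡⟨ *-distribˡ-∸ (suc m) X Y ⟨
      suc m * (X ∸ Y)       ∎

  [2+m]*Cat[2+m]≡[2+4m]*Cat[1+m] : ∀ m → suc (suc m) * Cat (suc (suc m)) ≡ (2 + 4 * m) * Cat (suc m)
  [2+m]*Cat[2+m]≡[2+4m]*Cat[1+m] m = *-cancelˡ-≡ _ _ (suc m) (begin
    suc m * (suc (suc m) * Cat (suc (suc m))) ≡⟨ cong (suc m *_) ([1+m]*Cat[1+m]≡[2m]Cm (suc m)) ⟩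
    suc m * ((2 * suc m) C suc m)             ≡⟨ [1+m]*[2+2m]C[1+m]≡2*[1+2m]*[2m]Cm m ⟩
    2 * suc (2 * m) * ((2 * m) C m)           ≡⟨ cong (2 * suc (2 * m) *_) ([1+m]*Cat[1+m]≡[2m]Cm m) ⟨
    2 * suc (2 * m) * (suc m * Cat (suc m))   ≡⟨ rearrange m (Cat (suc m)) ⟩
    suc m * ((2 + 4 * m) * Cat (suc m))       ∎)
    where
    rearrange : ∀ m c → 2 * suc (2 * m) * (suc m * c) ≡ suc m * ((2 + 4 * m) * c)
    rearrange = solve-∀

module PowerCoefficients where
  open import Data.Nat
  open import Data.Nat.Properties
  open import Data.Nat.Combinatorics
  open import Data.Nat.Tactic.RingSolver using (solve-∀)
  open import Data.Product using (_,_)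
  open import Data.Sum using (inj₁; inj₂)
  open import Function using (_∘_)
  open import Relation.Binary.PropositionalEquality
  open ≡-Reasoning
  open Binomial

  -- A series is its coefficient sequence ℕ → ℕ; x· f is x times f.
  x·_ : (ℕ → ℕ) → ℕ → ℕ
  (x· f) zero    = 0
  (x· f) (suc n) = f n

  -- coeff r n is the coefficient of xⁿ in (x + x²)ʳ
  coeff : ℕ → ℕ → ℕ
  coeff zero    zero    = 1
  coeff zero    (suc n) = 0
  coeff (suc r) zero    = 0
  coeff (suc r) (suc n) = coeff r n + (x· coeff r) n

  coeff-below : ∀ {r n} → n < r → coeff r n ≡ 0
  x·coeff-below : ∀ {r n} → n ≤ r → (x· coeff r) n ≡ 0

  coeff-below {suc r} {zero}  _         = refl
  coeff-below {suc r} {suc n} (s≤s n<r) = cong₂ _+_ (coeff-below n<r) (x·coeff-below (<⇒≤ n<r))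

  x·coeff-below {n = zero}  _   = refl
  x·coeff-below {n = suc n} n<r = coeff-below n<r

  coeff-diag : ∀ r → coeff r r ≡ 1
  coeff-diag zero    = refl
  coeff-diag (suc r) = cong₂ _+_ (coeff-diag r) (x·coeff-below {r} ≤-refl)

  coeff-offset : ∀ r k → coeff r (r + k) ≡ r C k
  coeff-offset zero    zero    = refl
  coeff-offset zero    (suc k) = refl
  coeff-offset (suc r) zero    = trans (cong (coeff (suc r) ∘ suc) (+-identityʳ r)) (coeff-diag (suc r))
  coeff-offset (suc r) (suc k) = begin
    coeff r (r + suc k) + (x· coeff r) (r + suc k) ≡⟨ cong (λ m → coeff r (r + suc k) + (x· coeff r) m) (+-suc r k) ⟩
    coeff r (r + suc k) + coeff r (r + k)          ≡⟨ cong₂ _+_ (coeff-offset r (suc k)) (coeff-offset r k) ⟩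
    r C suc k + r C k                              ≡⟨ +-comm (r C suc k) (r C k) ⟩
    r C k + r C suc k                              ≡⟨ nCk+nC[k+1]≡[n+1]C[k+1] r k ⟩
    suc r C suc k                                  ∎

  coeff-derivative : ∀ r n → suc n * coeff (suc r) (suc n) ≡ suc r * (coeff r n + 2 * (x· coeff r) n)
  coeff-derivative r n with <-≤-connex n r
  ... | inj₁ n<r = begin
    suc n * coeff (suc r) (suc n)          ≡⟨ cong (suc n *_) (coeff-below (s≤s n<r)) ⟩
    suc n * 0                              ≡⟨ *-zeroʳ (suc n) ⟩
    0                                      ≡⟨ *-zeroʳ (suc r) ⟨
    suc r * 0                              ≡⟨ cong₂ (λ x y → suc r * (x + 2 * y)) (coeff-below n<r) (x·coeff-below (<⇒≤ n<r)) ⟨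
    suc r * (coeff r n + 2 * (x· coeff r) n) ∎
  ... | inj₂ r≤n with (k , refl) ← m≤n⇒∃[o]m+o≡n r≤n = on-support k
    where
    on-support : ∀ k → suc (r + k) * coeff (suc r) (suc (r + k)) ≡ suc r * (coeff r (r + k) + 2 * (x· coeff r) (r + k))
    on-support zero rewrite +-identityʳ r = cong (suc r *_) (begin
      coeff (suc r) (suc r)              ≡⟨ coeff-diag (suc r) ⟩
      1                                  ≡⟨ cong₂ (λ x y → x + 2 * y) (coeff-diag r) (x·coeff-below {r} ≤-refl) ⟨
      coeff r r + 2 * (x· coeff r) r     ∎)
    on-support (suc j) = begin
      suc (r + suc j) * coeff (suc r) (suc r + suc j)       ≡⟨ cong (suc (r + suc j) *_) (coeff-offset (suc r) (suc j)) ⟩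
      suc (r + suc j) * (suc r C suc j)                     ≡⟨ [2+r+j]*[1+r]C[1+j]≡[1+r]*[rC[1+j]+2*rCj] r j ⟩
      suc r * (r C suc j + 2 * (r C j))
        ≡⟨ cong₂ (λ x y → suc r * (x + 2 * y)) (coeff-offset r (suc j)) (coeff-offset r j) ⟨
      suc r * (coeff r (r + suc j) + 2 * coeff r (r + j))
        ≡⟨ cong (λ m → suc r * (coeff r (r + suc j) + 2 * (x· coeff r) m)) (+-suc r j) ⟨
      suc r * (coeff r (r + suc j) + 2 * (x· coeff r) (r + suc j)) ∎

  -- coeff-derivative multiplied by 1 + 2x, using (1 + 2x)² = 1 + 4 (x + x²)
  coeff-[1+2x]*derivative : ∀ s n →
    suc n * coeff (suc s) (suc n) + 2 * n * coeff (suc s) n ≡ suc s * (coeff s n + 4 * coeff (suc s) n)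
  coeff-[1+2x]*derivative s zero = trans (+-identityʳ _) (coeff-derivative s zero)
  coeff-[1+2x]*derivative s (suc m) = begin
    suc (suc m) * coeff (suc s) (suc (suc m)) + 2 * suc m * coeff (suc s) (suc m)
      ≡⟨ cong₂ _+_ (coeff-derivative s (suc m)) (trans (*-assoc 2 (suc m) _) (cong (2 *_) (coeff-derivative s m))) ⟩
    suc s * (coeff s (suc m) + 2 * coeff s m) + 2 * (suc s * (coeff s m + 2 * (x· coeff s) m))
      ≡⟨ collect s (coeff s (suc m)) (coeff s m) ((x· coeff s) m) ⟩
    suc s * (coeff s (suc m) + 4 * coeff (suc s) (suc m)) ∎
    where
    collect : ∀ s a b c → suc s * (a + 2 * b) + 2 * (suc s * (b + 2 * c)) ≡ suc s * (a + 4 * (b + c))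
    collect = solve-∀

  coeff-above : ∀ {r n} → r + r < n → coeff r n ≡ 0
  coeff-above {r} {n} r+r<n with (k , refl) ← m≤n⇒∃[o]m+o≡n (m+n≤o⇒m≤o r (<⇒≤ r+r<n)) =
    trans (coeff-offset r k) (k>n⇒nCk≡0 (+-cancelˡ-< r r k r+r<n))

  coeff-binomial : ∀ {r n} → r ≤ n → coeff r n ≡ r C (n ∸ r)
  coeff-binomial {r} r≤n with (k , refl) ← m≤n⇒∃[o]m+o≡n r≤n =
    trans (coeff-offset r k) (cong (r C_) (sym (m+n∸m≡n r k)))

open import Data.Nat as ℕ using (ℕ; zero; suc; _∸_; _<_; _≥_; s≤s; z≤n)
import Data.Nat.Properties as ℕ
open import Data.Nat.Combinatorics using (_C_)
open import Data.Nat.DivMod using (m/n*n≤m; m<n*o⇒m/o<n)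
open import Data.Nat.Induction using (<-rec)
import Data.Nat.Tactic.RingSolver as ℕ-Solver
open import Data.Integer hiding (suc; _<_; _≤_; _≥_; _/_)
open import Data.Integer.Properties
open import Data.Integer.Tactic.RingSolver using (solve-∀)
open import Data.List using (map; applyUpTo; upTo)
open import Data.List.Properties using (map-∘)
open import Function using (_∘_)
open import Relation.Binary.PropositionalEquality
open import Relation.Nullary using (yes; no)
open import Relation.Nullary.Negation using (contradiction)
open ≡-Reasoning

open import Defs
open Catalan using ([2+m]*Cat[2+m]≡[2+4m]*Cat[1+m])
open PowerCoefficients using (coeff; coeff-below; coeff-diag; coeff-above; coeff-binomial; coeff-[1+2x]*derivative)

∑< : ℕ → (ℕ → ℤ) → ℤ
∑< zero    f = + 0
∑< (suc k) f = f 0 + ∑< k (f ∘ suc)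

infix 5 ∑<
syntax ∑< k (λ i → x) = ∑[ i < k ] x

∑-cong : ∀ k {f g : ℕ → ℤ} → (∀ i → i < k → f i ≡ g i) → ∑< k f ≡ ∑< k g
∑-cong zero    f≡g = refl
∑-cong (suc k) f≡g = cong₂ _+_ (f≡g 0 (s≤s z≤n)) (∑-cong k (λ i i<k → f≡g (suc i) (s≤s i<k)))

∑-zero : ∀ k {f : ℕ → ℤ} → (∀ i → i < k → f i ≡ + 0) → ∑< k f ≡ + 0
∑-zero zero    f≡0 = refl
∑-zero (suc k) f≡0 = cong₂ _+_ (f≡0 0 (s≤s z≤n)) (∑-zero k (λ i i<k → f≡0 (suc i) (s≤s i<k)))

∑-linear₂ : ∀ k a b (f g : ℕ → ℤ) → ∑[ i < k ] (a * f i + b * g i) ≡ a * ∑< k f + b * ∑< k g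
∑-linear₂ zero    a b f g = sym (cong₂ _+_ (*-zeroʳ a) (*-zeroʳ b))
∑-linear₂ (suc k) a b f g =
  trans (cong (_+_ (a * f 0 + b * g 0)) (∑-linear₂ k a b (f ∘ suc) (g ∘ suc))) (regroup a b _ _ _ _)
  where
  regroup : ∀ a b x y X Y → a * x + b * y + (a * X + b * Y) ≡ a * (x + X) + b * (y + Y)
  regroup = solve-∀

∑-linear₃ : ∀ k a b c (f g h : ℕ → ℤ) →
            ∑[ i < k ] (a * f i + b * g i + c * h i) ≡ a * ∑< k f + b * ∑< k g + c * ∑< k h
∑-linear₃ zero    a b c f g h = sym (cong₂ _+_ (cong₂ _+_ (*-zeroʳ a) (*-zeroʳ b)) (*-zeroʳ c))
∑-linear₃ (suc k) a b c f g h =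
  trans (cong (_+_ (a * f 0 + b * g 0 + c * h 0)) (∑-linear₃ k a b c (f ∘ suc) (g ∘ suc) (h ∘ suc)))
        (regroup a b c _ _ _ _ _ _)
  where
  regroup : ∀ a b c x y z X Y Z →
            a * x + b * y + c * z + (a * X + b * Y + c * Z) ≡ a * (x + X) + b * (y + Y) + c * (z + Z)
  regroup = solve-∀

∑-last : ∀ k (f : ℕ → ℤ) → ∑< (suc k) f ≡ ∑< k f + f k
∑-last zero    f = trans (+-identityʳ (f 0)) (sym (+-identityˡ (f 0)))
∑-last (suc k) f = trans (cong (_+_ (f 0)) (∑-last k (f ∘ suc))) (sym (+-assoc (f 0) _ _))

∑-telescope : ∀ k (g : ℕ → ℤ) → ∑[ i < k ] (g (suc i) - g i) ≡ g k - g 0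
∑-telescope zero    g = sym (+-inverseʳ (g 0))
∑-telescope (suc k) g = trans (cong (_+_ (g 1 - g 0)) (∑-telescope k (g ∘ suc))) (cancel (g 1) (g 0) (g (suc k)))
  where
  cancel : ∀ a b c → a - b + (c - a) ≡ c - b
  cancel = solve-∀

∑-split : ∀ j k (f : ℕ → ℤ) → ∑< (j ℕ.+ k) f ≡ ∑< j f + (∑[ i < k ] f (j ℕ.+ i))
∑-split zero    k f = sym (+-identityˡ _)
∑-split (suc j) k f = trans (cong (_+_ (f 0)) (∑-split j k (f ∘ suc))) (sym (+-assoc (f 0) _ _))

signedCat : ℕ → ℤ
signedCat r = (- (+ 1)) ^ r * (+ (Cat r))

δ₀ : ℕ → ℤ
δ₀ zero    = + 1
δ₀ (suc _) = + 0

-- coefficientwise form of (1 + 4y) C′ = 2C − 1 for C(y) = ∑ signedCat r yʳ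
signedCat-ode : ∀ s → + suc s * signedCat (suc s) ≡ - δ₀ s + (+ 2 - + 4 * + s) * signedCat s
signedCat-ode zero    = refl
signedCat-ode (suc m) = begin
  + suc (suc m) * (- (+ 1) * σ * + Cat (suc (suc m)))  ≡⟨ pull-sign (+ suc (suc m)) σ (+ Cat (suc (suc m))) ⟩
  - (σ * (+ suc (suc m) * + Cat (suc (suc m))))       ≡⟨ cong (λ z → - (σ * z)) (pos-* (suc (suc m)) (Cat (suc (suc m)))) ⟨
  - (σ * + (suc (suc m) ℕ.* Cat (suc (suc m))))       ≡⟨ cong (λ z → - (σ * + z)) ([2+m]*Cat[2+m]≡[2+4m]*Cat[1+m] m) ⟩
  - (σ * + ((2 ℕ.+ 4 ℕ.* m) ℕ.* Cat (suc m)))        ≡⟨ cong (λ z → - (σ * z)) cast ⟩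
  - (σ * ((+ 2 + + 4 * + m) * + Cat (suc m)))         ≡⟨ regroup σ (+ m) (+ Cat (suc m)) ⟩
  - + 0 + (+ 2 - + 4 * + suc m) * (σ * + Cat (suc m)) ∎
  where
  σ = (- (+ 1)) ^ suc m
  pull-sign : ∀ a σ c → a * (- (+ 1) * σ * c) ≡ - (σ * (a * c))
  pull-sign = solve-∀
  regroup : ∀ σ m c → - (σ * ((+ 2 + + 4 * m) * c)) ≡ - + 0 + (+ 2 - + 4 * (+ 1 + m)) * (σ * c)
  regroup = solve-∀
  cast : + ((2 ℕ.+ 4 ℕ.* m) ℕ.* Cat (suc m)) ≡ (+ 2 + + 4 * + m) * + Cat (suc m)
  cast = begin
    + ((2 ℕ.+ 4 ℕ.* m) ℕ.* Cat (suc m)) ≡⟨ pos-* (2 ℕ.+ 4 ℕ.* m) (Cat (suc m)) ⟩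
    + (2 ℕ.+ 4 ℕ.* m) * + Cat (suc m)   ≡⟨ cong (_* + Cat (suc m)) (trans (pos-+ 2 (4 ℕ.* m)) (cong (_+_ (+ 2)) (pos-* 4 m))) ⟩
    (+ 2 + + 4 * + m) * + Cat (suc m)   ∎

coeff-[1+2x]*derivativeℤ : ∀ s n →
  + suc n * + coeff (suc s) (suc n) + + 2 * + n * + coeff (suc s) n ≡ + suc s * (+ coeff s n + + 4 * + coeff (suc s) n)
coeff-[1+2x]*derivativeℤ s n = begin
  + suc n * + x + + 2 * + n * + y         ≡⟨ cong₂ _+_ (pos-* (suc n) x) (trans (pos-* (2 ℕ.* n) y) (cong (_* + y) (pos-* 2 n))) ⟨
  + (suc n ℕ.* x) + + (2 ℕ.* n ℕ.* y)     ≡⟨ pos-+ (suc n ℕ.* x) _ ⟨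
  + (suc n ℕ.* x ℕ.+ 2 ℕ.* n ℕ.* y)       ≡⟨ cong +_ (coeff-[1+2x]*derivative s n) ⟩
  + (suc s ℕ.* (z ℕ.+ 4 ℕ.* y))           ≡⟨ pos-* (suc s) _ ⟩
  + suc s * + (z ℕ.+ 4 ℕ.* y)             ≡⟨ cong (+ suc s *_) (trans (pos-+ z _) (cong (_+_ (+ z)) (pos-* 4 y))) ⟩
  + suc s * (+ z + + 4 * + y)             ∎
  where
  x = coeff (suc s) (suc n)
  y = coeff (suc s) n
  z = coeff s n

-- composed n = [xⁿ] C(x + x²)
composed : ℕ → ℤ
composed n = ∑[ r < suc n ] + coeff r n * signedCat r

module _ (n : ℕ) where

  private
    g : ℕ → ℤ
    g r = + r * (+ coeff r n * signedCat r)

  composed-suc : composed (suc n) ≡ ∑[ s < suc n ] + coeff (suc s) (suc n) * signedCat (suc s)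
  composed-suc = +-identityˡ _

  composed-shift : composed n ≡ ∑[ s < suc n ] + coeff (suc s) n * signedCat (suc s)
  composed-shift = begin
    + coeff 0 n * + 0 + ∑< n G           ≡⟨ cong (_+ ∑< n G) (*-zeroʳ (+ coeff 0 n)) ⟩
    + 0 + ∑< n G                          ≡⟨ +-identityˡ _ ⟩
    ∑< n G                                ≡⟨ +-identityʳ _ ⟨
    ∑< n G + + 0
      ≡⟨ cong (_+_ (∑< n G)) (cong (λ k → + k * signedCat (suc n)) (coeff-below (ℕ.n<1+n n))) ⟨
    ∑< n G + G n                          ≡⟨ ∑-last n G ⟨
    ∑< (suc n) G                          ∎
    where
    G : ℕ → ℤ
    G s = + coeff (suc s) n * signedCat (suc s)

  private
    pointwise : ∀ s →
      + suc n * (+ coeff (suc s) (suc n) * signedCat (suc s)) + + 2 * + n * (+ coeff (suc s) n * signedCat (suc s))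
      ≡ - (+ 1) * (+ coeff s n * δ₀ s) + + 2 * (+ coeff s n * signedCat s) + + 4 * (g (suc s) - g s)
    pointwise s = begin
      + suc n * (u * c′) + + 2 * + n * (v * c′)            ≡⟨ factor-out (+ suc n) u c′ (+ n) v ⟩
      (+ suc n * u + + 2 * + n * v) * c′                   ≡⟨ cong (_* c′) (coeff-[1+2x]*derivativeℤ s n) ⟩
      + suc s * (w + + 4 * v) * c′                         ≡⟨ distribute (+ suc s) w v c′ ⟩
      w * (+ suc s * c′) + + 4 * g (suc s)                 ≡⟨ cong (λ z → w * z + + 4 * g (suc s)) (signedCat-ode s) ⟩
      w * (- δ₀ s + (+ 2 - + 4 * + s) * c) + + 4 * g (suc s) ≡⟨ regroup w (δ₀ s) (+ s) c (g (suc s)) ⟩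
      - (+ 1) * (w * δ₀ s) + + 2 * (w * c) + + 4 * (g (suc s) - + s * (w * c)) ∎
      where
      u = + coeff (suc s) (suc n)
      v = + coeff (suc s) n
      w = + coeff s n
      c = signedCat s
      c′ = signedCat (suc s)
      factor-out : ∀ a b x m c → a * (b * x) + + 2 * m * (c * x) ≡ (a * b + + 2 * m * c) * x
      factor-out = solve-∀
      distribute : ∀ a x y c → a * (x + + 4 * y) * c ≡ x * (a * c) + + 4 * (a * (y * c))
      distribute = solve-∀
      regroup : ∀ x d s c G → x * (- d + (+ 2 - + 4 * s) * c) + + 4 * G ≡ - (+ 1) * (x * d) + + 2 * (x * c) + + 4 * (G - s * (x * c))
      regroup = solve-∀

    ∑-δ₀ : ∑[ s < suc n ] + coeff s n * δ₀ s ≡ δ₀ n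
    ∑-δ₀ = trans (cong₂ _+_ (coeff0≡δ₀ n) (∑-zero n (λ i _ → *-zeroʳ (+ coeff (suc i) n)))) (+-identityʳ (δ₀ n))
      where
      coeff0≡δ₀ : ∀ n → + coeff 0 n * + 1 ≡ δ₀ n
      coeff0≡δ₀ zero    = refl
      coeff0≡δ₀ (suc n) = refl

    g-boundary : g (suc n) - g 0 ≡ + 0
    g-boundary = cong₂ _-_ g-top (*-zeroˡ (+ coeff 0 n * signedCat 0))
      where
      g-top : g (suc n) ≡ + 0
      g-top = begin
        + suc n * (+ coeff (suc n) n * signedCat (suc n))
          ≡⟨ cong (λ x → + suc n * (+ x * signedCat (suc n))) (coeff-below (ℕ.n<1+n n)) ⟩
        + suc n * (+ 0 * signedCat (suc n))               ≡⟨ cong (+ suc n *_) (*-zeroˡ (signedCat (suc n))) ⟩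
        + suc n * + 0                                     ≡⟨ *-zeroʳ (+ suc n) ⟩
        + 0                                               ∎

  -- coefficientwise form of (1 + 2x) H′ = 2H − 1 for H(x) = C(x + x²)
  composed-ode : + suc n * composed (suc n) + + 2 * + n * composed n ≡ + 2 * composed n - δ₀ n
  composed-ode = begin
    + suc n * composed (suc n) + + 2 * + n * composed n
      ≡⟨ cong₂ (λ u v → + suc n * u + + 2 * + n * v) composed-suc composed-shift ⟩
    + suc n * ∑< (suc n) F + + 2 * + n * ∑< (suc n) G
      ≡⟨ ∑-linear₂ (suc n) (+ suc n) (+ 2 * + n) F G ⟨
    ∑[ s < suc n ] (+ suc n * F s + + 2 * + n * G s)
      ≡⟨ ∑-cong (suc n) (λ s _ → pointwise s) ⟩
    ∑[ s < suc n ] (- (+ 1) * X s + + 2 * Y s + + 4 * (g (suc s) - g s))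
      ≡⟨ ∑-linear₃ (suc n) (- (+ 1)) (+ 2) (+ 4) X Y (λ s → g (suc s) - g s) ⟩
    - (+ 1) * ∑< (suc n) X + + 2 * composed n + + 4 * (∑[ s < suc n ] (g (suc s) - g s))
      ≡⟨ cong₂ (λ u v → - (+ 1) * u + + 2 * composed n + + 4 * v) ∑-δ₀ (trans (∑-telescope (suc n) g) g-boundary) ⟩
    - (+ 1) * δ₀ n + + 2 * composed n + + 4 * + 0
      ≡⟨ tidy (δ₀ n) (composed n) ⟩
    + 2 * composed n - δ₀ n ∎
    where
    F G X Y : ℕ → ℤ
    F s = + coeff (suc s) (suc n) * signedCat (suc s)
    G s = + coeff (suc s) n * signedCat (suc s)
    X s = + coeff s n * δ₀ s
    Y s = + coeff s n * signedCat s
    tidy : ∀ d h → - (+ 1) * d + + 2 * h + + 4 * + 0 ≡ + 2 * h - d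
    tidy = solve-∀

vanishing-propagates : ∀ n → composed (suc n) ≡ + 0 → composed (suc (suc n)) ≡ + 0
vanishing-propagates n composed[1+n]≡0 = *-cancelˡ-≡ (+ suc (suc n)) _ _ (begin
  + suc (suc n) * H                                     ≡⟨ add-zero (+ suc (suc n)) H (+ 2 * + suc n) ⟩
  + suc (suc n) * H + + 2 * + suc n * + 0               ≡⟨ cong (λ h → + suc (suc n) * H + + 2 * + suc n * h) composed[1+n]≡0 ⟨
  + suc (suc n) * H + + 2 * + suc n * composed (suc n)  ≡⟨ composed-ode (suc n) ⟩
  + 2 * composed (suc n) - + 0                          ≡⟨ cong (λ h → + 2 * h - + 0) composed[1+n]≡0 ⟩
  + 0                                                   ≡⟨ *-zeroʳ (+ suc (suc n)) ⟨
  + suc (suc n) * + 0                                   ∎)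
  where
  H = composed (suc (suc n))
  add-zero : ∀ a h b → a * h ≡ a * h + b * + 0
  add-zero = solve-∀

composed-vanishes : ∀ m → composed (suc (suc m)) ≡ + 0
composed-vanishes zero    = refl
composed-vanishes (suc m) = vanishing-propagates (suc m) (composed-vanishes m)

∑-below-diagonal : ∀ n → - (∑[ r < n ] + coeff r n * signedCat r) ≡ signedCat n - composed n
∑-below-diagonal n = begin
  - S                                 ≡⟨ cancel S (signedCat n) ⟩
  signedCat n - (S + + 1 * signedCat n) ≡⟨ cong (λ c → signedCat n - (S + + c * signedCat n)) (coeff-diag n) ⟨
  signedCat n - (S + Y n)             ≡⟨ cong (_-_ (signedCat n)) (∑-last n Y) ⟨
  signedCat n - composed n            ∎
  where
  Y : ℕ → ℤ
  Y r = + coeff r n * signedCat r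
  S = ∑< n Y
  cancel : ∀ s c → - s ≡ c - (s + + 1 * c)
  cancel = solve-∀

sumℤ-map-applyUpTo : ∀ k (f : ℕ → ℤ) (φ : ℕ → ℕ) → sumℤ (map f (applyUpTo φ k)) ≡ ∑< k (f ∘ φ)
sumℤ-map-applyUpTo zero    f φ = refl
sumℤ-map-applyUpTo (suc k) f φ = cong (_+_ (f (φ 0))) (sumℤ-map-applyUpTo k f (φ ∘ suc))

⌈n/2⌉<n : ∀ {n} → 2 ℕ.≤ n → ⌈ n /2⌉ < n
⌈n/2⌉<n {n} 2≤n = m<n*o⇒m/o<n (subst (n ℕ.+ 1 <_) (n+n≡n*2 n) (ℕ.+-monoʳ-< n 2≤n))
  where
  n+n≡n*2 : ∀ n → n ℕ.+ n ≡ n ℕ.* 2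
  n+n≡n*2 = ℕ-Solver.solve-∀

i<⌈n/2⌉⇒i+i<n : ∀ {i n} → i < ⌈ n /2⌉ → i ℕ.+ i < n
i<⌈n/2⌉⇒i+i<n {i} {n} i<⌈n/2⌉ = ℕ.≤-pred (subst₂ ℕ._≤_ ([1+i]*2≡2+i+i i) (ℕ.+-comm n 1)
  (ℕ.≤-trans (ℕ.*-monoˡ-≤ 2 i<⌈n/2⌉) (m/n*n≤m (n ℕ.+ 1) 2)))
  where
  [1+i]*2≡2+i+i : ∀ i → suc i ℕ.* 2 ≡ suc (suc (i ℕ.+ i))
  [1+i]*2≡2+i+i = ℕ-Solver.solve-∀

-- the terms with r < ⌈n/2⌉ that step omits all vanish
step-as-sum : ∀ m f → let n = suc (suc m) in step f n ≡ - (∑[ r < n ] + coeff r n * f r)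
step-as-sum m f = cong -_ (begin
  sumℤ (map B (map (lo ℕ.+_) (upTo (n ∸ lo))))  ≡⟨ cong sumℤ (map-∘ (upTo (n ∸ lo))) ⟨
  sumℤ (map (B ∘ (lo ℕ.+_)) (upTo (n ∸ lo)))    ≡⟨ sumℤ-map-applyUpTo (n ∸ lo) (B ∘ (lo ℕ.+_)) (λ i → i) ⟩
  ∑[ i < n ∸ lo ] B (lo ℕ.+ i)                  ≡⟨ ∑-cong (n ∸ lo) (λ i i<n∸lo → binomial-term (below-n i<n∸lo)) ⟩
  ∑[ i < n ∸ lo ] T (lo ℕ.+ i)                  ≡⟨ +-identityˡ _ ⟨
  + 0 + (∑[ i < n ∸ lo ] T (lo ℕ.+ i))          ≡⟨ cong (_+ (∑[ i < n ∸ lo ] T (lo ℕ.+ i))) omitted ⟨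
  ∑< lo T + (∑[ i < n ∸ lo ] T (lo ℕ.+ i))      ≡⟨ ∑-split lo (n ∸ lo) T ⟨
  ∑< (lo ℕ.+ (n ∸ lo)) T                        ≡⟨ cong (λ k → ∑< k T) (ℕ.m+[n∸m]≡n lo≤n) ⟩
  ∑< n T                                        ∎)
  where
  n = suc (suc m)
  lo = ⌈ n /2⌉
  lo≤n : lo ℕ.≤ n
  lo≤n = ℕ.<⇒≤ (⌈n/2⌉<n (s≤s (s≤s z≤n)))
  B T : ℕ → ℤ
  B r = + (r C (n ∸ r)) * f r
  T r = + coeff r n * f r
  binomial-term : ∀ {r} → r < n → B r ≡ T r
  binomial-term r<n = cong (λ c → + c * f _) (sym (coeff-binomial (ℕ.<⇒≤ r<n)))
  below-n : ∀ {i} → i < n ∸ lo → lo ℕ.+ i < n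
  below-n {i} i<n∸lo = subst (lo ℕ.+ i <_) (ℕ.m+[n∸m]≡n lo≤n) (ℕ.+-monoʳ-< lo i<n∸lo)
  omitted : ∑< lo T ≡ + 0
  omitted = ∑-zero lo λ i i<lo →
    trans (cong (λ c → + c * f i) (coeff-above {i} (i<⌈n/2⌉⇒i+i<n {n = n} i<lo))) (*-zeroˡ (f i))

a-suc : ∀ k → a (suc k) ≡ step (tbl k) (suc k)
a-suc k with suc k ℕ.≤? k
... | yes 1+k≤k = contradiction 1+k≤k (ℕ.n≮n k)
... | no  _     = refl

tbl-stable : ∀ {k r} → r ℕ.≤ k → tbl k r ≡ a r
tbl-stable {zero}  z≤n = refl
tbl-stable {suc k} {r} r≤1+k with r ℕ.≤? k
... | yes r≤k = tbl-stable r≤k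
... | no  r≰k with refl ← ℕ.≤-antisym r≤1+k (ℕ.≰⇒> r≰k) = sym (a-suc k)

a≡signedCat-step : ∀ n → (∀ {r} → r < n → a r ≡ signedCat r) → a n ≡ signedCat n
a≡signedCat-step zero          _  = refl
a≡signedCat-step (suc zero)    _  = refl
a≡signedCat-step n@(suc (suc m)) ih = begin
  a n                                          ≡⟨ a-suc (suc m) ⟩
  step (tbl (suc m)) n                         ≡⟨ step-as-sum m (tbl (suc m)) ⟩
  - (∑[ r < n ] + coeff r n * tbl (suc m) r)   ≡⟨ cong -_ (∑-cong n (λ r r<n → cong (+ coeff r n *_) (earlier r<n))) ⟩
  - (∑[ r < n ] + coeff r n * signedCat r)     ≡⟨ ∑-below-diagonal n ⟩
  signedCat n - composed n                     ≡⟨ cong (_-_ (signedCat n)) (composed-vanishes m) ⟩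
  signedCat n - + 0                            ≡⟨ +-identityʳ (signedCat n) ⟩
  signedCat n                                  ∎
  where
  earlier : ∀ {r} → r < n → tbl (suc m) r ≡ signedCat r
  earlier r<n = trans (tbl-stable (ℕ.≤-pred r<n)) (ih r<n)

a≡signedCat : ∀ n → a n ≡ signedCat n
a≡signedCat = <-rec _ a≡signedCat-step

theorem2 : (n : ℕ) → n ≥ 1 → a n ≡ (- (+ 1)) ^ n * (+ (Cat n))
theorem2 n _ = a≡signedCat n
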